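{- For every $g\in D_3$ we have $g\circ\sharp=\sharp\circ g$ as maps $\Re\to U(\mathfrak{sl}_2)$, where on the left $g$ acts on $U(\mathfrak{sl}_2)$ and on the right $g$ acts on $\Re$, via the $D_3$-actions described in the context.
   Context: $U(\mathfrak{sl}_2)$ is the $\mathbb C$-algebra generated by $E,F,H$ subject to $[H,E]=2E$, $[H,F]=-2F$, $[E,F]=H$ ($[x,y]=xy-yx$, $\mathbf i=\sqrt{ -1}$). The universal Racah algebra $\Re$ is generated by $A,B,C,\Delta$ subject to $[A,B]=[B,C]=[C,A]=2\Delta$ and the requirement that each of $[A,\Delta]+AC-BA$, $[B,\Delta]+BA-CB$, $[C,\Delta]+CB-AC$ is central. $\sharp:\Re\to U(\mathfrak{sl}_2)$ is the algebra homomorphism with $A\mapsto \frac{(E+F-2)(E+F+2)}{16}$, $B\mapsto\frac{(H-2)(H+2)}{16}$, $C\mapsto \frac{(\mathbf iE-\mathbf iF-2)(\mathbf iE-\mathbf iF+2)}{16}$, $\Delta\mapsto\frac{(H+2)F^2-(H-2)E^2}{64}$. The group $D_3=\langle\sigma,\tau\mid \sigma^2=\tau^3=(\sigma\tau)^2=1\rangle$ acts on $U(\mathfrak{sl}_2)$ by algebra automorphisms with $\sigma$: $E\mapsto\mathbf iF$, $F\mapsto-\mathbf iE$, $H\mapsto-H$, and $\tau$: $E\mapsto\frac{H-\mathbf iE-\mathbf iF}{2}$, $F\mapsto\frac{H+\mathbf iE+\mathbf iF}{2}$, $H\mapsto\mathbf iE-\mathbf iF$. It acts on $\Re$ by algebra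 automorphisms with $\sigma$: $A\mapsto C$, $B\mapsto B$, $C\mapsto A$, $\Delta\mapsto-\Delta$, and $\tau$: $A\mapsto B$, $B\mapsto C$, $C\mapsto A$, $\Delta\mapsto\Delta$. -}

module Defs where

open import Level using (Level; _⊔_)
open import Algebra.Bundles using (CommutativeRing)
open import Data.List using (List; []; _∷_)

-- Free unital associative K-algebra on a set of generators G, and its
-- quotient by a family of defining relations R (as an inductive
-- congruence, i.e. a setoid presentation of K⟨G⟩ / (R)).

module FreeAlgebra {c ℓ} (K : CommutativeRing c ℓ) where
  open CommutativeRing K using (0#; 1#; -_) renaming (Carrier to Kc; _+_ to _+K_; _*_ to _*K_; _≈_ to _≈K_)

  infixl 6 _⊕_
  infixl 7 _⊗_

  data Term (G : Set) : Set c where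
    gen : G → Term G
    con : Kc → Term G
    _⊕_ : Term G → Term G → Term G
    _⊗_ : Term G → Term G → Term G

  module _ {G : Set} where
    infixl 6 _⊖_
    _⊖_ : Term G → Term G → Term G
    x ⊖ y = x ⊕ con (- 1#) ⊗ y

  data Eq {G : Set} (R : Term G → Term G → Set c) : Term G → Term G → Set (c ⊔ ℓ) where
    ≈-refl  : ∀ {x} → Eq R x x
    ≈-sym   : ∀ {x y} → Eq R x y → Eq R y x
    ≈-trans : ∀ {x y z} → Eq R x y → Eq R y z → Eq R x z
    ⊕-cong  : ∀ {x x′ y y′} → Eq R x x′ → Eq R y y′ → Eq R (x ⊕ y) (x′ ⊕ y′)
    ⊗-cong  : ∀ {x x′ y y′} → Eq R x x′ → Eq R y y′ → Eq R (x ⊗ y) (x′ ⊗ y′)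
    ⊕-assoc : ∀ x y z → Eq R ((x ⊕ y) ⊕ z) (x ⊕ (y ⊕ z))
    ⊕-comm  : ∀ x y → Eq R (x ⊕ y) (y ⊕ x)
    ⊕-idˡ   : ∀ x → Eq R (con 0# ⊕ x) x
    ⊕-invˡ  : ∀ x → Eq R (con (- 1#) ⊗ x ⊕ x) (con 0#)
    ⊗-assoc : ∀ x y z → Eq R ((x ⊗ y) ⊗ z) (x ⊗ (y ⊗ z))
    ⊗-idˡ   : ∀ x → Eq R (con 1# ⊗ x) x
    ⊗-idʳ   : ∀ x → Eq R (x ⊗ con 1#) x
    distribˡ : ∀ x y z → Eq R (x ⊗ (y ⊕ z)) (x ⊗ y ⊕ x ⊗ z)
    distribʳ : ∀ x y z → Eq R ((y ⊕ z) ⊗ x) (y ⊗ x ⊕ z ⊗ x)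
    con-cong : ∀ {a b} → a ≈K b → Eq R (con a) (con b)
    con-+    : ∀ a b → Eq R (con (a +K b)) (con a ⊕ con b)
    con-*    : ∀ a b → Eq R (con (a *K b)) (con a ⊗ con b)
    con-central : ∀ a x → Eq R (con a ⊗ x) (x ⊗ con a)
    rel      : ∀ {x y} → R x y → Eq R x y

  extend : {G G′ : Set} → (G → Term G′) → Term G → Term G′
  extend f (gen g) = f g
  extend f (con a) = con a
  extend f (x ⊕ y) = extend f x ⊕ extend f y
  extend f (x ⊗ y) = extend f x ⊗ extend f y

-- The concrete objects of the paper, over a coefficient ring K with a
-- square root of -1 (i) and an inverse of 2 (h).  K = ℂ is the case of
-- the paper.

data UGen : Set where
  E F H : UGen

data RGen : Set where
  A B C Δ : RGen

-- generators of D₃ = ⟨σ, τ⟩; a word g₁ ∷ … ∷ gₙ denotes g₁ ⋯ gₙ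
data D3Gen : Set where
  σ τ : D3Gen

module Sl2Racah {c ℓ} (K : CommutativeRing c ℓ) (i h : CommutativeRing.Carrier K) where
  open CommutativeRing K using (1#; -_) renaming (Carrier to Kc; _+_ to _+K_; _*_ to _*K_)
  open FreeAlgebra K public

  two : Kc
  two = 1# +K 1#

  -- 1/16 = h⁴ and 1/64 = h⁶
  h⁴ h⁶ : Kc
  h⁴ = h *K h *K h *K h
  h⁶ = h⁴ *K h *K h

  UTerm : Set c
  UTerm = Term UGen

  RTerm : Set c
  RTerm = Term RGen

  e f hh : UTerm
  e = gen E
  f = gen F
  hh = gen H

  data Sl2Rel : UTerm → UTerm → Set c where
    HE : Sl2Rel (hh ⊗ e ⊖ e ⊗ hh) (con two ⊗ e)
    HF : Sl2Rel (hh ⊗ f ⊖ f ⊗ hh) (con (- two) ⊗ f)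
    EF : Sl2Rel (e ⊗ f ⊖ f ⊗ e) hh

  _≈U_ : UTerm → UTerm → Set (c ⊔ ℓ)
  _≈U_ = Eq Sl2Rel

  ♯gen : RGen → UTerm
  ♯gen A = con h⁴ ⊗ ((e ⊕ f ⊖ con two) ⊗ (e ⊕ f ⊕ con two))
  ♯gen B = con h⁴ ⊗ ((hh ⊖ con two) ⊗ (hh ⊕ con two))
  ♯gen C = con h⁴ ⊗ ((con i ⊗ e ⊖ con i ⊗ f ⊖ con two) ⊗ (con i ⊗ e ⊖ con i ⊗ f ⊕ con two))
  ♯gen Δ = con h⁶ ⊗ ((hh ⊕ con two) ⊗ f ⊗ f ⊖ (hh ⊖ con two) ⊗ e ⊗ e)

  ♯ : RTerm → UTerm
  ♯ = extend ♯gen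

  actUgen : D3Gen → UGen → UTerm
  actUgen σ E = con i ⊗ f
  actUgen σ F = con (- i) ⊗ e
  actUgen σ H = con (- 1#) ⊗ hh
  actUgen τ E = con h ⊗ (hh ⊖ con i ⊗ e ⊖ con i ⊗ f)
  actUgen τ F = con h ⊗ (hh ⊕ con i ⊗ e ⊕ con i ⊗ f)
  actUgen τ H = con i ⊗ e ⊖ con i ⊗ f

  actRgen : D3Gen → RGen → RTerm
  actRgen σ A = gen C
  actRgen σ B = gen B
  actRgen σ C = gen A
  actRgen σ Δ = con (- 1#) ⊗ gen Δ
  actRgen τ A = gen B
  actRgen τ B = gen C
  actRgen τ C = gen A
  actRgen τ Δ = gen Δ

  actU : List D3Gen → UTerm → UTerm
  actU []       x = x
  actU (g ∷ gs) x = extend (actUgen g) (actU gs x)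

  actR : List D3Gen → RTerm → RTerm
  actR []       x = x
  actR (g ∷ gs) x = extend (actRgen g) (actR gs x)

{-# OPTIONS --safe #-}
module Submission where

-- Both actions and ♯ are algebra maps defined on generators (`extend`), so the
-- theorem reduces, by induction on the word and on the term, to fourteen
-- identities in U(sl₂): σ and τ preserve the three defining relations
-- [H,E] = 2E, [H,F] = -2F, [E,F] = H, and g ∘ ♯ agrees with ♯ ∘ g on A, B, C, Δ.
-- These involve only scalars in ℤ[i, ½], so they are decided by a normaliser
-- proved sound: expand into words, rewrite each word into the PBW order
-- F < H < E using the commutation relations, merge equal words, and check that
-- every coefficient, computed exactly in ℤ[i, ½], vanishes.

open import Level using (0ℓ; _⊔_) renaming (suc to lsuc)
open import Algebra.Bundles using (CommutativeRing; Ring)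
open import Algebra.Bundles.Raw using (RawRing)
open import Algebra.Solver.Ring.AlmostCommutativeRing
  using (_-Raw-AlmostCommutative⟶_; fromCommutativeRing)
import Algebra.Solver.Ring
import Algebra.Properties.Ring as RingProperties
import Algebra.Properties.Group as GroupProperties
import Algebra.Properties.AbelianGroup as AbelianGroupProperties
import Algebra.Properties.CommutativeSemigroup as CommutativeSemigroupProperties
import Algebra.Properties.Semiring.Mult as SemiringMultiplication
import Algebra.Properties.Semiring.Exp as SemiringExponentiation
open import Data.Bool.Base using (Bool; true; T; _∧_)
open import Data.Bool.Properties using (T-∧)
open import Data.Integer.Base as ℤ using (ℤ; +_; -[1+_]; _◃_; sign; ∣_∣)
open import Data.Integer.Properties as ℤ using ([1+m]⊖[1+n]≡m⊖n; ◃-inverse)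
open import Data.List.Base using (List; []; _∷_; _++_; map; foldr; cartesianProductWith)
import Data.List.Properties as List
open import Data.Maybe.Base as Maybe using (Maybe; just; nothing)
open import Data.Nat.Base as ℕ using (ℕ; zero; suc)
import Data.Nat.Properties as ℕ
open import Data.Product.Base as Product using (_,_; proj₁; proj₂)
open import Data.Sign.Base as Sign using (Sign)
open import Function.Bundles using (Equivalence)
open import Relation.Binary.Definitions using (DecidableEquality)
open import Relation.Binary.PropositionalEquality.Core as ≡ using (_≡_)
open import Relation.Nullary.Decidable.Core using (yes; no; ⌊_⌋; toWitness)

open import Defs

module IntegerEmbedding {c ℓ} (K : CommutativeRing c ℓ) where
  open CommutativeRing K
  open RingProperties ring using (-‿distribˡ-*; -‿distribʳ-*; -‿involutive; -0#≈0#)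
  open AbelianGroupProperties +-abelianGroup using (⁻¹-∙-comm)
  open CommutativeSemigroupProperties +-commutativeSemigroup using (interchange)
  open SemiringMultiplication semiring using (_×_; ×-homo-+; ×1-homo-*)
  open import Relation.Binary.Reasoning.Setoid setoid

  fromℤ : ℤ → Carrier
  fromℤ (+ n)    = n × 1#
  fromℤ -[1+ n ] = - (suc n × 1#)

  signed : Sign → Carrier → Carrier
  signed Sign.+ x = x
  signed Sign.- x = - x

  signed-cong : ∀ s {x y} → x ≈ y → signed s x ≈ signed s y
  signed-cong Sign.+ x≈y = x≈y
  signed-cong Sign.- x≈y = -‿cong x≈y

  signed-* : ∀ s t x y → signed (s Sign.* t) (x * y) ≈ signed s x * signed t y
  signed-* Sign.+ Sign.+ x y = refl
  signed-* Sign.+ Sign.- x y = -‿distribʳ-* x y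
  signed-* Sign.- Sign.+ x y = -‿distribˡ-* x y
  signed-* Sign.- Sign.- x y = begin
    x * y           ≈⟨ -‿involutive _ ⟨
    - - (x * y)     ≈⟨ -‿cong (-‿distribˡ-* x y) ⟩
    - (- x * y)     ≈⟨ -‿distribʳ-* (- x) y ⟩
    - x * - y       ∎

  fromℤ-⊖ : ∀ m n → fromℤ (m ℤ.⊖ n) ≈ m × 1# - n × 1#
  fromℤ-⊖ m       zero    = sym (trans (+-congˡ -0#≈0#) (+-identityʳ _))
  fromℤ-⊖ zero    (suc n) = sym (+-identityˡ _)
  fromℤ-⊖ (suc m) (suc n) rewrite [1+m]⊖[1+n]≡m⊖n m n = begin
    fromℤ (m ℤ.⊖ n)                   ≈⟨ fromℤ-⊖ m n ⟩
    m × 1# - n × 1#                   ≈⟨ +-identityˡ _ ⟨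
    0# + (m × 1# - n × 1#)            ≈⟨ +-congʳ (-‿inverseʳ 1#) ⟨
    (1# - 1#) + (m × 1# - n × 1#)     ≈⟨ interchange _ _ _ _ ⟩
    (1# + m × 1#) + (- 1# - n × 1#)   ≈⟨ +-congˡ (⁻¹-∙-comm _ _) ⟩
    (1# + m × 1#) - (1# + n × 1#)     ∎

  fromℤ-+ : ∀ i j → fromℤ (i ℤ.+ j) ≈ fromℤ i + fromℤ j
  fromℤ-+ (+ m)    (+ n)    = ×-homo-+ 1# m n
  fromℤ-+ (+ m)    -[1+ n ] = fromℤ-⊖ m (suc n)
  fromℤ-+ -[1+ m ] (+ n)    = trans (fromℤ-⊖ n (suc m)) (+-comm _ _)
  fromℤ-+ -[1+ m ] -[1+ n ] = begin
    - (suc (suc (m ℕ.+ n)) × 1#)          ≡⟨ ≡.cong (λ k → - (k × 1#)) (ℕ.+-suc (suc m) n) ⟨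
    - ((suc m ℕ.+ suc n) × 1#)            ≈⟨ -‿cong (×-homo-+ 1# (suc m) (suc n)) ⟩
    - (suc m × 1# + suc n × 1#)           ≈⟨ ⁻¹-∙-comm _ _ ⟨
    - (suc m × 1#) - (suc n × 1#)         ∎

  fromℤ-neg : ∀ i → fromℤ (ℤ.- i) ≈ - fromℤ i
  fromℤ-neg (+ zero)  = sym -0#≈0#
  fromℤ-neg (+ suc n) = refl
  fromℤ-neg -[1+ n ]  = sym (-‿involutive _)

  fromℤ-◃ : ∀ s n → fromℤ (s ◃ n) ≈ signed s (n × 1#)
  fromℤ-◃ Sign.+ zero    = refl
  fromℤ-◃ Sign.- zero    = sym -0#≈0#
  fromℤ-◃ Sign.+ (suc n) = refl
  fromℤ-◃ Sign.- (suc n) = refl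

  fromℤ-signAbs : ∀ i → fromℤ i ≈ signed (sign i) (∣ i ∣ × 1#)
  fromℤ-signAbs i = trans (reflexive (≡.cong fromℤ (≡.sym (◃-inverse i)))) (fromℤ-◃ (sign i) ∣ i ∣)

  fromℤ-* : ∀ i j → fromℤ (i ℤ.* j) ≈ fromℤ i * fromℤ j
  fromℤ-* i j = begin
    fromℤ (s ◃ ∣ i ∣ ℕ.* ∣ j ∣)                                  ≈⟨ fromℤ-◃ s (∣ i ∣ ℕ.* ∣ j ∣) ⟩
    signed s ((∣ i ∣ ℕ.* ∣ j ∣) × 1#)                           ≈⟨ signed-cong s (×1-homo-* ∣ i ∣ ∣ j ∣) ⟩
    signed s (∣ i ∣ × 1# * ∣ j ∣ × 1#)                           ≈⟨ signed-* (sign i) (sign j) _ _ ⟩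
    signed (sign i) (∣ i ∣ × 1#) * signed (sign j) (∣ j ∣ × 1#)  ≈⟨ *-cong (fromℤ-signAbs i) (fromℤ-signAbs j) ⟨
    fromℤ i * fromℤ j                                           ∎
    where s = sign i Sign.* sign j

  fromℤ-homomorphism : ℤ.+-*-rawRing -Raw-AlmostCommutative⟶ fromCommutativeRing K
  fromℤ-homomorphism = record
    { ⟦_⟧    = fromℤ
    ; +-homo = fromℤ-+
    ; *-homo = fromℤ-*
    ; -‿homo = fromℤ-neg
    ; 0-homo = refl
    ; 1-homo = +-identityʳ 1#
    }

  fromℤ-≟ : ∀ i j → Maybe (fromℤ i ≈ fromℤ j)
  fromℤ-≟ i j with i ℤ.≟ j
  ... | yes ≡.refl = just refl
  ... | no _       = nothing

  module Solver = Algebra.Solver.Ring ℤ.+-*-rawRing (fromCommutativeRing K) fromℤ-homomorphism fromℤ-≟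

module _ {c ℓ} (K : CommutativeRing c ℓ) where
  open CommutativeRing K using (Carrier; _≈_; _+_; _*_; -_; 0#; 1#; reflexive)

  IsImaginaryUnit : Carrier → Set ℓ
  IsImaginaryUnit i = i * i ≈ - 1#

  IsHalf : Carrier → Set ℓ
  IsHalf h = (1# + 1#) * h ≈ 1#

  record Coefficients : Set (c ⊔ ℓ ⊔ lsuc 0ℓ) where
    field
      rawRing      : RawRing 0ℓ 0ℓ
      homomorphism : rawRing -Raw-AlmostCommutative⟶ fromCommutativeRing K
    open RawRing rawRing public using () renaming (Carrier to Code)
    open _-Raw-AlmostCommutative⟶_ homomorphism public
    field
      isZero       : Code → Bool
      isZero-sound : ∀ x → T (isZero x) → ⟦ x ⟧ ≈ 0#

  integers : Coefficients
  integers = record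
    { rawRing      = ℤ.+-*-rawRing
    ; homomorphism = fromℤ-homomorphism
    ; isZero       = λ n → ⌊ n ℤ.≟ + 0 ⌋
    ; isZero-sound = λ n n≟0 → reflexive (≡.cong fromℤ (toWitness n≟0))
    }
    where open IntegerEmbedding K

module GaussianExtension {c ℓ} {K : CommutativeRing c ℓ} (𝒞 : Coefficients K)
  (i : CommutativeRing.Carrier K) (i*i≈-1 : IsImaginaryUnit K i) where
  open CommutativeRing K
  open RingProperties ring using (-1*x≈-x)
  open IntegerEmbedding.Solver K using (solve; _:=_; _:+_; _:*_; :-_)
  open import Data.Product.Base using (_×_)
  open import Relation.Binary.Reasoning.Setoid setoid
  private
    module C = Coefficients 𝒞
    module Cᵣ = RawRing C.rawRing

  Code : Set
  Code = C.Code × C.Code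

  ⟦_⟧ᵍ : Code → Carrier
  ⟦ x , y ⟧ᵍ = C.⟦ x ⟧ + C.⟦ y ⟧ * i

  _+ᵍ_ _*ᵍ_ : Code → Code → Code
  (x , y) +ᵍ (x′ , y′) = x Cᵣ.+ x′ , y Cᵣ.+ y′
  (x , y) *ᵍ (x′ , y′) = x Cᵣ.* x′ Cᵣ.+ Cᵣ.- (y Cᵣ.* y′) , x Cᵣ.* y′ Cᵣ.+ y Cᵣ.* x′

  -ᵍ_ : Code → Code
  -ᵍ (x , y) = Cᵣ.- x , Cᵣ.- y

  +-homo : ∀ u v → ⟦ u +ᵍ v ⟧ᵍ ≈ ⟦ u ⟧ᵍ + ⟦ v ⟧ᵍ
  +-homo (x , y) (x′ , y′) = begin
    C.⟦ x Cᵣ.+ x′ ⟧ + C.⟦ y Cᵣ.+ y′ ⟧ * i     ≈⟨ +-cong (C.+-homo x x′) (*-congʳ (C.+-homo y y′)) ⟩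
    (X + X′) + (Y + Y′) * i                   ≈⟨ solve 5 (λ X X′ Y Y′ i →
                                                   (X :+ X′) :+ (Y :+ Y′) :* i := (X :+ Y :* i) :+ (X′ :+ Y′ :* i))
                                                   refl X X′ Y Y′ i ⟩
    (X + Y * i) + (X′ + Y′ * i)               ∎
    where X = C.⟦ x ⟧; X′ = C.⟦ x′ ⟧; Y = C.⟦ y ⟧; Y′ = C.⟦ y′ ⟧

  *-homo : ∀ u v → ⟦ u *ᵍ v ⟧ᵍ ≈ ⟦ u ⟧ᵍ * ⟦ v ⟧ᵍ
  *-homo (x , y) (x′ , y′) = begin
    C.⟦ x Cᵣ.* x′ Cᵣ.+ Cᵣ.- (y Cᵣ.* y′) ⟧ + C.⟦ x Cᵣ.* y′ Cᵣ.+ y Cᵣ.* x′ ⟧ * i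
      ≈⟨ +-cong (trans (C.+-homo _ _) (+-cong (C.*-homo x x′) (trans (C.-‿homo _) (-‿cong (C.*-homo y y′)))))
                (*-congʳ (trans (C.+-homo _ _) (+-cong (C.*-homo x y′) (C.*-homo y x′)))) ⟩
    (X * X′ - Y * Y′) + (X * Y′ + Y * X′) * i
      ≈⟨ +-congʳ (+-congˡ -YY′≈YY′ii) ⟩
    (X * X′ + Y * Y′ * (i * i)) + (X * Y′ + Y * X′) * i
      ≈⟨ solve 5 (λ X X′ Y Y′ i →
           (X :* X′ :+ Y :* Y′ :* (i :* i)) :+ (X :* Y′ :+ Y :* X′) :* i := (X :+ Y :* i) :* (X′ :+ Y′ :* i))
           refl X X′ Y Y′ i ⟩
    (X + Y * i) * (X′ + Y′ * i)
      ∎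
    where
    X = C.⟦ x ⟧; X′ = C.⟦ x′ ⟧; Y = C.⟦ y ⟧; Y′ = C.⟦ y′ ⟧
    -YY′≈YY′ii : - (Y * Y′) ≈ Y * Y′ * (i * i)
    -YY′≈YY′ii = sym (trans (*-congˡ i*i≈-1) (trans (*-comm _ _) (-1*x≈-x _)))

  -‿homo : ∀ u → ⟦ -ᵍ u ⟧ᵍ ≈ - ⟦ u ⟧ᵍ
  -‿homo (x , y) = begin
    C.⟦ Cᵣ.- x ⟧ + C.⟦ Cᵣ.- y ⟧ * i   ≈⟨ +-cong (C.-‿homo x) (*-congʳ (C.-‿homo y)) ⟩
    - X + - Y * i                     ≈⟨ solve 3 (λ X Y i → :- X :+ :- Y :* i := :- (X :+ Y :* i)) refl X Y i ⟩
    - (X + Y * i)                     ∎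
    where X = C.⟦ x ⟧; Y = C.⟦ y ⟧

  embed : C.Code → Code
  embed x = x , Cᵣ.0#

  ⟦embed⟧ : ∀ x → ⟦ embed x ⟧ᵍ ≈ C.⟦ x ⟧
  ⟦embed⟧ x = trans (+-congˡ (trans (*-congʳ C.0-homo) (zeroˡ i))) (+-identityʳ _)

  coefficients : Coefficients K
  coefficients = record
    { rawRing      = record
      { Carrier = Code ; _≈_ = _≡_ ; _+_ = _+ᵍ_ ; _*_ = _*ᵍ_ ; -_ = -ᵍ_
      ; 0# = embed Cᵣ.0# ; 1# = embed Cᵣ.1# }
    ; homomorphism = record
      { ⟦_⟧ = ⟦_⟧ᵍ ; +-homo = +-homo ; *-homo = *-homo ; -‿homo = -‿homo
      ; 0-homo = trans (⟦embed⟧ Cᵣ.0#) C.0-homo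
      ; 1-homo = trans (⟦embed⟧ Cᵣ.1#) C.1-homo }
    ; isZero       = λ (x , y) → C.isZero x ∧ C.isZero y
    ; isZero-sound = λ (x , y) x,y≈0 → let (x≈0 , y≈0) = Equivalence.to T-∧ x,y≈0 in
        trans (+-cong (C.isZero-sound x x≈0) (trans (*-congʳ (C.isZero-sound y y≈0)) (zeroˡ i))) (+-identityʳ 0#)
    }

  √-1 : Code
  √-1 = Cᵣ.0# , Cᵣ.1#

  ⟦√-1⟧ : ⟦ √-1 ⟧ᵍ ≈ i
  ⟦√-1⟧ = trans (+-cong C.0-homo (trans (*-congʳ C.1-homo) (*-identityˡ i))) (+-identityˡ i)

module DyadicExtension {c ℓ} {K : CommutativeRing c ℓ} (𝒞 : Coefficients K)
  (h : CommutativeRing.Carrier K) (2h≈1 : IsHalf K h) where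
  open CommutativeRing K
  open RingProperties ring using (-‿distribˡ-*)
  open SemiringExponentiation semiring using (_^_; ^-homo-*)
  open IntegerEmbedding.Solver K using (solve; _:=_; _:*_)
  open import Data.Product.Base using (_×_)
  open import Relation.Binary.Reasoning.Setoid setoid
  private
    module C = Coefficients 𝒞
    module Cᵣ = RawRing C.rawRing

  Code : Set
  Code = C.Code × ℕ

  ⟦_⟧ᵈ : Code → Carrier
  ⟦ z , k ⟧ᵈ = C.⟦ z ⟧ * h ^ k

  two : C.Code
  two = Cᵣ.1# Cᵣ.+ Cᵣ.1#

  two^ : ℕ → C.Code
  two^ zero    = Cᵣ.1#
  two^ (suc n) = two Cᵣ.* two^ n

  -- Summands are brought to the larger exponent, which keeps exponents bounded along long sums.
  _+ᵈ_ _*ᵈ_ : Code → Code → Code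
  (z , k) +ᵈ (z′ , k′) = z Cᵣ.* two^ (m ℕ.∸ k) Cᵣ.+ z′ Cᵣ.* two^ (m ℕ.∸ k′) , m
    where m = k ℕ.⊔ k′
  (z , k) *ᵈ (z′ , k′) = z Cᵣ.* z′ , k ℕ.+ k′

  -ᵈ_ : Code → Code
  -ᵈ (z , k) = Cᵣ.- z , k

  ⟦two⟧*h≈1 : C.⟦ two ⟧ * h ≈ 1#
  ⟦two⟧*h≈1 = trans (*-congʳ (trans (C.+-homo _ _) (+-cong C.1-homo C.1-homo))) 2h≈1

  rescale : ∀ z d k → C.⟦ z Cᵣ.* two^ d ⟧ * h ^ (d ℕ.+ k) ≈ C.⟦ z ⟧ * h ^ k
  rescale z zero    k = *-congʳ (trans (C.*-homo z Cᵣ.1#) (trans (*-congˡ C.1-homo) (*-identityʳ _)))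
  rescale z (suc d) k = begin
    C.⟦ z Cᵣ.* (two Cᵣ.* two^ d) ⟧ * (h * P)      ≈⟨ *-congʳ (trans (C.*-homo z _) (*-congˡ (C.*-homo two _))) ⟩
    Z * (W * D) * (h * P)                         ≈⟨ solve 5 (λ Z W D h P →
                                                      Z :* (W :* D) :* (h :* P) := (W :* h) :* (Z :* D :* P))
                                                      refl Z W D h P ⟩
    (W * h) * (Z * D * P)                         ≈⟨ *-cong ⟦two⟧*h≈1 (*-congʳ (sym (C.*-homo z (two^ d)))) ⟩
    1# * (C.⟦ z Cᵣ.* two^ d ⟧ * P)               ≈⟨ *-identityˡ _ ⟩
    C.⟦ z Cᵣ.* two^ d ⟧ * P                      ≈⟨ rescale z d k ⟩
    C.⟦ z ⟧ * h ^ k                               ∎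
    where
    Z = C.⟦ z ⟧; W = C.⟦ two ⟧; D = C.⟦ two^ d ⟧; P = h ^ (d ℕ.+ k)

  rescale-≤ : ∀ z {k m} → k ℕ.≤ m → C.⟦ z Cᵣ.* two^ (m ℕ.∸ k) ⟧ * h ^ m ≈ C.⟦ z ⟧ * h ^ k
  rescale-≤ z {k} {m} k≤m =
    trans (*-congˡ (reflexive (≡.cong (h ^_) (≡.sym (ℕ.m∸n+n≡m k≤m))))) (rescale z (m ℕ.∸ k) k)

  +-homo : ∀ u v → ⟦ u +ᵈ v ⟧ᵈ ≈ ⟦ u ⟧ᵈ + ⟦ v ⟧ᵈ
  +-homo (z , k) (z′ , k′) = begin
    C.⟦ a Cᵣ.+ b ⟧ * h ^ m             ≈⟨ *-congʳ (C.+-homo a b) ⟩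
    (C.⟦ a ⟧ + C.⟦ b ⟧) * h ^ m       ≈⟨ distribʳ _ _ _ ⟩
    C.⟦ a ⟧ * h ^ m + C.⟦ b ⟧ * h ^ m ≈⟨ +-cong (rescale-≤ z (ℕ.m≤m⊔n k k′)) (rescale-≤ z′ (ℕ.m≤n⊔m k k′)) ⟩
    C.⟦ z ⟧ * h ^ k + C.⟦ z′ ⟧ * h ^ k′ ∎
    where
    m = k ℕ.⊔ k′
    a = z Cᵣ.* two^ (m ℕ.∸ k)
    b = z′ Cᵣ.* two^ (m ℕ.∸ k′)

  *-homo : ∀ u v → ⟦ u *ᵈ v ⟧ᵈ ≈ ⟦ u ⟧ᵈ * ⟦ v ⟧ᵈ
  *-homo (z , k) (z′ , k′) = begin
    C.⟦ z Cᵣ.* z′ ⟧ * h ^ (k ℕ.+ k′)       ≈⟨ *-cong (C.*-homo z z′) (^-homo-* h k k′) ⟩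
    Z * Z′ * (h ^ k * h ^ k′)             ≈⟨ solve 4 (λ Z Z′ H H′ → Z :* Z′ :* (H :* H′) := Z :* H :* (Z′ :* H′))
                                              refl Z Z′ (h ^ k) (h ^ k′) ⟩
    Z * h ^ k * (Z′ * h ^ k′)             ∎
    where Z = C.⟦ z ⟧; Z′ = C.⟦ z′ ⟧

  -‿homo : ∀ u → ⟦ -ᵈ u ⟧ᵈ ≈ - ⟦ u ⟧ᵈ
  -‿homo (z , k) = trans (*-congʳ (C.-‿homo z)) (sym (-‿distribˡ-* _ _))

  embed : C.Code → Code
  embed z = z , 0

  ⟦embed⟧ : ∀ z → ⟦ embed z ⟧ᵈ ≈ C.⟦ z ⟧
  ⟦embed⟧ z = *-identityʳ _

  coefficients : Coefficients K
  coefficients = record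
    { rawRing      = record
      { Carrier = Code ; _≈_ = _≡_ ; _+_ = _+ᵈ_ ; _*_ = _*ᵈ_ ; -_ = -ᵈ_
      ; 0# = embed Cᵣ.0# ; 1# = embed Cᵣ.1# }
    ; homomorphism = record
      { ⟦_⟧ = ⟦_⟧ᵈ ; +-homo = +-homo ; *-homo = *-homo ; -‿homo = -‿homo
      ; 0-homo = trans (⟦embed⟧ Cᵣ.0#) C.0-homo
      ; 1-homo = trans (⟦embed⟧ Cᵣ.1#) C.1-homo }
    ; isZero       = λ (z , k) → C.isZero z
    ; isZero-sound = λ (z , k) z≈0 → trans (*-congʳ (C.isZero-sound z z≈0)) (zeroˡ _)
    }

  ½ : Code
  ½ = Cᵣ.1# , 1

  ⟦½⟧ : ⟦ ½ ⟧ᵈ ≈ h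
  ⟦½⟧ = trans (*-congʳ C.1-homo) (trans (*-identityˡ _) (*-identityʳ h))

module _ {c ℓ} (K : CommutativeRing c ℓ) where
  open FreeAlgebra K
  private module K = CommutativeRing K

  presentedRing : {G : Set} → (Term G → Term G → Set c) → Ring c (c ⊔ ℓ)
  presentedRing {G} R = record
    { Carrier = Term G
    ; _≈_     = Eq R
    ; _+_     = _⊕_
    ; _*_     = _⊗_
    ; -_      = con (K.- K.1#) ⊗_
    ; 0#      = con K.0#
    ; 1#      = con K.1#
    ; isRing  = record
      { +-isAbelianGroup = record
        { isGroup = record
          { isMonoid = record
            { isSemigroup = record
              { isMagma = record
                { isEquivalence = record { refl = ≈-refl ; sym = ≈-sym ; trans = ≈-trans }
                ; ∙-cong        = ⊕-cong
                }
              ; assoc = ⊕-assoc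
              }
            ; identity = ⊕-idˡ , λ x → ≈-trans (⊕-comm x _) (⊕-idˡ x)
            }
          ; inverse = ⊕-invˡ , λ x → ≈-trans (⊕-comm x _) (⊕-invˡ x)
          ; ⁻¹-cong = ⊗-cong ≈-refl
          }
        ; comm = ⊕-comm
        }
      ; *-cong     = ⊗-cong
      ; *-assoc    = ⊗-assoc
      ; *-identity = ⊗-idˡ , ⊗-idʳ
      ; distrib    = distribˡ , distribʳ
      }
    }

  module _ {G G′ : Set} {R : Term G → Term G → Set c} {R′ : Term G′ → Term G′ → Set c}
    (φ : G → Term G′) (φ-resp : ∀ {x y} → R x y → Eq R′ (extend φ x) (extend φ y)) where

    extend-cong : ∀ {x y} → Eq R x y → Eq R′ (extend φ x) (extend φ y)
    extend-cong ≈-refl               = ≈-refl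
    extend-cong (≈-sym p)            = ≈-sym (extend-cong p)
    extend-cong (≈-trans p q)        = ≈-trans (extend-cong p) (extend-cong q)
    extend-cong (⊕-cong p q)         = ⊕-cong (extend-cong p) (extend-cong q)
    extend-cong (⊗-cong p q)         = ⊗-cong (extend-cong p) (extend-cong q)
    extend-cong (⊕-assoc x y z)      = ⊕-assoc _ _ _
    extend-cong (⊕-comm x y)         = ⊕-comm _ _
    extend-cong (⊕-idˡ x)            = ⊕-idˡ _
    extend-cong (⊕-invˡ x)           = ⊕-invˡ _
    extend-cong (⊗-assoc x y z)      = ⊗-assoc _ _ _
    extend-cong (⊗-idˡ x)            = ⊗-idˡ _
    extend-cong (⊗-idʳ x)            = ⊗-idʳ _
    extend-cong (distribˡ x y z)     = distribˡ _ _ _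
    extend-cong (distribʳ x y z)     = distribʳ _ _ _
    extend-cong (con-cong a≈b)       = con-cong a≈b
    extend-cong (con-+ a b)          = con-+ a b
    extend-cong (con-* a b)          = con-* a b
    extend-cong (con-central a x)    = con-central a _
    extend-cong (rel r)              = φ-resp r

  extend-intertwines : {G G′ : Set} {R′ : Term G′ → Term G′ → Set c}
    (f : G → Term G′) (φ : G′ → Term G′) (ψ : G → Term G) →
    (∀ g → Eq R′ (extend φ (f g)) (extend f (ψ g))) →
    ∀ x → Eq R′ (extend φ (extend f x)) (extend f (extend ψ x))
  extend-intertwines f φ ψ on-gen (gen g) = on-gen g
  extend-intertwines f φ ψ on-gen (con a) = ≈-refl
  extend-intertwines f φ ψ on-gen (x ⊕ y) =
    ⊕-cong (extend-intertwines f φ ψ on-gen x) (extend-intertwines f φ ψ on-gen y)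
  extend-intertwines f φ ψ on-gen (x ⊗ y) =
    ⊗-cong (extend-intertwines f φ ψ on-gen x) (extend-intertwines f φ ψ on-gen y)

-- Terms whose constants are names: a name can be evaluated in K and also coded in a
-- computable coefficient ring, which an arbitrary element of K cannot.
infixl 6 _⊕_
infixl 7 _⊗_

data Expr (G Q : Set) : Set where
  gen     : G → Expr G Q
  con     : Q → Expr G Q
  _⊕_ _⊗_ : Expr G Q → Expr G Q → Expr G Q

extendₑ : {G G′ Q : Set} → (G → Expr G′ Q) → Expr G Q → Expr G′ Q
extendₑ φ (gen x) = φ x
extendₑ φ (con q) = con q
extendₑ φ (e ⊕ f) = extendₑ φ e ⊕ extendₑ φ f
extendₑ φ (e ⊗ f) = extendₑ φ e ⊗ extendₑ φ f

module Normalisation {c ℓ} {K : CommutativeRing c ℓ} (𝒞 : Coefficients K)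
  {G : Set} (_≟_ : DecidableEquality G) (R : FreeAlgebra.Term K G → FreeAlgebra.Term K G → Set c) where
  open import Data.Product.Base using (_×_)
  open FreeAlgebra K
  open Coefficients 𝒞 using (Code; ⟦_⟧; +-homo; *-homo; -‿homo; 1-homo; isZero; isZero-sound)
  open Ring (presentedRing K R)
    using (_≈_; -_; _-_; setoid; zeroˡ; zeroʳ; +-identityʳ; +-commutativeSemigroup; +-group; +-abelianGroup)
  open RingProperties (presentedRing K R) using (-0#≈0#)
  open CommutativeSemigroupProperties +-commutativeSemigroup using (x∙yz≈y∙xz)
  open AbelianGroupProperties +-abelianGroup using (⁻¹-∙-comm)
  open GroupProperties +-group using (x∙y⁻¹≈ε⇒x≈y; //-rightDividesˡ)
  open import Relation.Binary.Reasoning.Setoid setoid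
  private
    module K = CommutativeRing K
    module C = RawRing (Coefficients.rawRing 𝒞)

  Word : Set
  Word = List G

  Monomial : Set
  Monomial = Code × Word

  Polynomial : Set
  Polynomial = List Monomial

  ⟦_⟧ʷ : Word → Term G
  ⟦ []    ⟧ʷ = con K.1#
  ⟦ x ∷ w ⟧ʷ = gen x ⊗ ⟦ w ⟧ʷ

  ⟦_⟧ᵐ : Monomial → Term G
  ⟦ a , w ⟧ᵐ = con ⟦ a ⟧ ⊗ ⟦ w ⟧ʷ

  ⟦_⟧ᵖ : Polynomial → Term G
  ⟦ []    ⟧ᵖ = con K.0#
  ⟦ m ∷ p ⟧ᵖ = ⟦ m ⟧ᵐ ⊕ ⟦ p ⟧ᵖ

  word : Word → Polynomial
  word w = (C.1# , w) ∷ []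

  _*ᵐ_ : Monomial → Monomial → Monomial
  (a , u) *ᵐ (b , v) = a C.* b , u ++ v

  _*ᵖ_ : Polynomial → Polynomial → Polynomial
  _*ᵖ_ = cartesianProductWith _*ᵐ_

  -ᵖ_ : Polynomial → Polynomial
  -ᵖ_ = map (Product.map₁ C.-_)

  ⟦++⟧ʷ : ∀ u v → ⟦ u ++ v ⟧ʷ ≈ ⟦ u ⟧ʷ ⊗ ⟦ v ⟧ʷ
  ⟦++⟧ʷ []      v = ≈-sym (⊗-idˡ _)
  ⟦++⟧ʷ (x ∷ u) v = ≈-trans (⊗-cong ≈-refl (⟦++⟧ʷ u v)) (≈-sym (⊗-assoc _ _ _))

  ⟦++⟧ᵖ : ∀ p q → ⟦ p ++ q ⟧ᵖ ≈ ⟦ p ⟧ᵖ ⊕ ⟦ q ⟧ᵖ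
  ⟦++⟧ᵖ []      q = ≈-sym (⊕-idˡ _)
  ⟦++⟧ᵖ (m ∷ p) q = ≈-trans (⊕-cong ≈-refl (⟦++⟧ᵖ p q)) (≈-sym (⊕-assoc _ _ _))

  ⟦word⟧ : ∀ w → ⟦ word w ⟧ᵖ ≈ ⟦ w ⟧ʷ
  ⟦word⟧ w = ≈-trans (+-identityʳ _) (≈-trans (⊗-cong (con-cong 1-homo) ≈-refl) (⊗-idˡ _))

  ⟦*ᵐ⟧ : ∀ m n → ⟦ m *ᵐ n ⟧ᵐ ≈ ⟦ m ⟧ᵐ ⊗ ⟦ n ⟧ᵐ
  ⟦*ᵐ⟧ (a , u) (b , v) = begin
    con ⟦ a C.* b ⟧ ⊗ ⟦ u ++ v ⟧ʷ      ≈⟨ ⊗-cong (≈-trans (con-cong (*-homo a b)) (con-* _ _)) (⟦++⟧ʷ u v) ⟩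
    (con α ⊗ con β) ⊗ (U ⊗ V)         ≈⟨ ⊗-assoc _ _ _ ⟩
    con α ⊗ (con β ⊗ (U ⊗ V))         ≈⟨ ⊗-cong ≈-refl (≈-sym (⊗-assoc _ _ _)) ⟩
    con α ⊗ ((con β ⊗ U) ⊗ V)         ≈⟨ ⊗-cong ≈-refl (⊗-cong (con-central β U) ≈-refl) ⟩
    con α ⊗ ((U ⊗ con β) ⊗ V)         ≈⟨ ⊗-cong ≈-refl (⊗-assoc _ _ _) ⟩
    con α ⊗ (U ⊗ (con β ⊗ V))         ≈⟨ ⊗-assoc _ _ _ ⟨
    (con α ⊗ U) ⊗ (con β ⊗ V)         ∎
    where α = ⟦ a ⟧; β = ⟦ b ⟧; U = ⟦ u ⟧ʷ; V = ⟦ v ⟧ʷ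

  ⟦*ᵖ⟧ : ∀ p q → ⟦ p *ᵖ q ⟧ᵖ ≈ ⟦ p ⟧ᵖ ⊗ ⟦ q ⟧ᵖ
  ⟦*ᵖ⟧ []      q = ≈-sym (zeroˡ _)
  ⟦*ᵖ⟧ (m ∷ p) q = begin
    ⟦ map (m *ᵐ_) q ++ p *ᵖ q ⟧ᵖ             ≈⟨ ⟦++⟧ᵖ (map (m *ᵐ_) q) (p *ᵖ q) ⟩
    ⟦ map (m *ᵐ_) q ⟧ᵖ ⊕ ⟦ p *ᵖ q ⟧ᵖ          ≈⟨ ⊕-cong (⟦map*ᵐ⟧ q) (⟦*ᵖ⟧ p q) ⟩
    ⟦ m ⟧ᵐ ⊗ ⟦ q ⟧ᵖ ⊕ ⟦ p ⟧ᵖ ⊗ ⟦ q ⟧ᵖ         ≈⟨ distribʳ _ _ _ ⟨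
    (⟦ m ⟧ᵐ ⊕ ⟦ p ⟧ᵖ) ⊗ ⟦ q ⟧ᵖ               ∎
    where
    ⟦map*ᵐ⟧ : ∀ q → ⟦ map (m *ᵐ_) q ⟧ᵖ ≈ ⟦ m ⟧ᵐ ⊗ ⟦ q ⟧ᵖ
    ⟦map*ᵐ⟧ []      = ≈-sym (zeroʳ _)
    ⟦map*ᵐ⟧ (n ∷ q) = ≈-trans (⊕-cong (⟦*ᵐ⟧ m n) (⟦map*ᵐ⟧ q)) (≈-sym (distribˡ _ _ _))

  ⟦-ᵖ⟧ : ∀ p → ⟦ -ᵖ p ⟧ᵖ ≈ - ⟦ p ⟧ᵖ
  ⟦-ᵖ⟧ []            = ≈-sym -0#≈0#
  ⟦-ᵖ⟧ ((a , w) ∷ p) = begin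
    con ⟦ C.- a ⟧ ⊗ ⟦ w ⟧ʷ ⊕ ⟦ -ᵖ p ⟧ᵖ          ≈⟨ ⊕-cong (⊗-cong ⟦-a⟧≈-1*⟦a⟧ ≈-refl) (⟦-ᵖ⟧ p) ⟩
    (con (K.- K.1#) ⊗ con ⟦ a ⟧) ⊗ ⟦ w ⟧ʷ ⊕ - ⟦ p ⟧ᵖ ≈⟨ ⊕-cong (⊗-assoc _ _ _) ≈-refl ⟩
    - ⟦ a , w ⟧ᵐ ⊕ - ⟦ p ⟧ᵖ                      ≈⟨ ⁻¹-∙-comm _ _ ⟩
    - (⟦ a , w ⟧ᵐ ⊕ ⟦ p ⟧ᵖ)                      ∎
    where
    ⟦-a⟧≈-1*⟦a⟧ : con ⟦ C.- a ⟧ ≈ con (K.- K.1#) ⊗ con ⟦ a ⟧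
    ⟦-a⟧≈-1*⟦a⟧ = ≈-trans (con-cong (K.trans (-‿homo a) (K.sym (-1*x≈-x _)))) (con-* _ _)
      where open RingProperties K.ring using (-1*x≈-x)

  ⟦single⟧ : ∀ a x → ⟦ (a , x ∷ []) ∷ [] ⟧ᵖ ≈ con ⟦ a ⟧ ⊗ gen x
  ⟦single⟧ a x = ≈-trans (+-identityʳ _) (⊗-cong ≈-refl (⊗-idʳ _))

  x-y≈z⇒x≈y+z : ∀ {x y z} → x - y ≈ z → x ≈ y ⊕ z
  x-y≈z⇒x≈y+z {x} {y} x-y≈z =
    ≈-trans (≈-sym (//-rightDividesˡ y x)) (≈-trans (⊕-cong x-y≈z ≈-refl) (⊕-comm _ _))

  insert : Monomial → Polynomial → Polynomial
  insert m [] = m ∷ []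
  insert (a , w) ((b , v) ∷ p) with List.≡-dec _≟_ w v
  ... | yes _ = (a C.+ b , v) ∷ p
  ... | no  _ = (b , v) ∷ insert (a , w) p

  ⟦insert⟧ : ∀ m p → ⟦ insert m p ⟧ᵖ ≈ ⟦ m ⟧ᵐ ⊕ ⟦ p ⟧ᵖ
  ⟦insert⟧ m [] = ≈-refl
  ⟦insert⟧ (a , w) ((b , v) ∷ p) with List.≡-dec _≟_ w v
  ... | yes ≡.refl = begin
    con ⟦ a C.+ b ⟧ ⊗ ⟦ w ⟧ʷ ⊕ ⟦ p ⟧ᵖ
      ≈⟨ ⊕-cong (⊗-cong (≈-trans (con-cong (+-homo a b)) (con-+ _ _)) ≈-refl) ≈-refl ⟩
    (con ⟦ a ⟧ ⊕ con ⟦ b ⟧) ⊗ ⟦ w ⟧ʷ ⊕ ⟦ p ⟧ᵖ           ≈⟨ ⊕-cong (distribʳ _ _ _) ≈-refl ⟩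
    ⟦ a , w ⟧ᵐ ⊕ ⟦ b , w ⟧ᵐ ⊕ ⟦ p ⟧ᵖ                    ≈⟨ ⊕-assoc _ _ _ ⟩
    ⟦ a , w ⟧ᵐ ⊕ (⟦ b , w ⟧ᵐ ⊕ ⟦ p ⟧ᵖ)                  ∎
  ... | no _ = ≈-trans (⊕-cong ≈-refl (⟦insert⟧ (a , w) p)) (x∙yz≈y∙xz _ _ _)

  collect : Polynomial → Polynomial
  collect = foldr insert []

  ⟦collect⟧ : ∀ p → ⟦ collect p ⟧ᵖ ≈ ⟦ p ⟧ᵖ
  ⟦collect⟧ []      = ≈-refl
  ⟦collect⟧ (m ∷ p) = ≈-trans (⟦insert⟧ m (collect p)) (⊕-cong ≈-refl (⟦collect⟧ p))

  isZeroᵖ : Polynomial → Bool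
  isZeroᵖ []            = true
  isZeroᵖ ((a , _) ∷ p) = isZero a ∧ isZeroᵖ p

  isZeroᵖ-sound : ∀ p → T (isZeroᵖ p) → ⟦ p ⟧ᵖ ≈ con K.0#
  isZeroᵖ-sound []            _      = ≈-refl
  isZeroᵖ-sound ((a , w) ∷ p) a,p≈0 = begin
    con ⟦ a ⟧ ⊗ ⟦ w ⟧ʷ ⊕ ⟦ p ⟧ᵖ
      ≈⟨ ⊕-cong (⊗-cong (con-cong (isZero-sound a a≈0)) ≈-refl) (isZeroᵖ-sound p p≈0) ⟩
    con K.0# ⊗ ⟦ w ⟧ʷ ⊕ con K.0#   ≈⟨ +-identityʳ _ ⟩
    con K.0# ⊗ ⟦ w ⟧ʷ              ≈⟨ zeroˡ _ ⟩
    con K.0#                       ∎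
    where
    a≈0 = proj₁ (Equivalence.to T-∧ a,p≈0)
    p≈0 = proj₂ (Equivalence.to T-∧ a,p≈0)

  -- commute x y ≡ just p declares the pair x y out of order, with commutator p.
  module Rewriting
    (commute : G → G → Maybe Polynomial)
    (commutator : ∀ {x y p} → commute x y ≡ just p → gen x ⊗ gen y - gen y ⊗ gen x ≈ ⟦ p ⟧ᵖ)
    where

    rewriteFrom : G → Word → Maybe Polynomial
    rewriteFrom x []      = nothing
    rewriteFrom x (y ∷ w) with commute x y
    ... | just p  = just ((word (y ∷ x ∷ []) ++ p) *ᵖ word w)
    ... | nothing = Maybe.map (word (x ∷ []) *ᵖ_) (rewriteFrom y w)

    rewriteFrom-sound : ∀ x w {p} → rewriteFrom x w ≡ just p → ⟦ x ∷ w ⟧ʷ ≈ ⟦ p ⟧ᵖ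
    rewriteFrom-sound x (y ∷ w) eq with commute x y in xy≡p
    ... | just p with ≡.refl ← eq = begin
      gen x ⊗ (gen y ⊗ ⟦ w ⟧ʷ)                           ≈⟨ ⊗-assoc _ _ _ ⟨
      (gen x ⊗ gen y) ⊗ ⟦ w ⟧ʷ                           ≈⟨ ⊗-cong (x-y≈z⇒x≈y+z (commutator xy≡p)) ≈-refl ⟩
      (gen y ⊗ gen x ⊕ ⟦ p ⟧ᵖ) ⊗ ⟦ w ⟧ʷ                  ≈⟨ ⊗-cong (⊕-cong (⊗-cong ≈-refl (⊗-idʳ _)) ≈-refl) ≈-refl ⟨
      (⟦ y ∷ x ∷ [] ⟧ʷ ⊕ ⟦ p ⟧ᵖ) ⊗ ⟦ w ⟧ʷ                ≈⟨ ⊗-cong (⊕-cong (⟦word⟧ (y ∷ x ∷ [])) ≈-refl) (⟦word⟧ w) ⟨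
      (⟦ word (y ∷ x ∷ []) ⟧ᵖ ⊕ ⟦ p ⟧ᵖ) ⊗ ⟦ word w ⟧ᵖ    ≈⟨ ⊗-cong (⟦++⟧ᵖ (word (y ∷ x ∷ [])) p) ≈-refl ⟨
      ⟦ word (y ∷ x ∷ []) ++ p ⟧ᵖ ⊗ ⟦ word w ⟧ᵖ          ≈⟨ ⟦*ᵖ⟧ (word (y ∷ x ∷ []) ++ p) (word w) ⟨
      ⟦ (word (y ∷ x ∷ []) ++ p) *ᵖ word w ⟧ᵖ            ∎
    ... | nothing with rewriteFrom y w in yw≡q
    ...   | just q with ≡.refl ← eq = begin
      gen x ⊗ ⟦ y ∷ w ⟧ʷ                         ≈⟨ ⊗-cong ≈-refl (rewriteFrom-sound y w yw≡q) ⟩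
      gen x ⊗ ⟦ q ⟧ᵖ                             ≈⟨ ⊗-cong (≈-trans (⟦word⟧ (x ∷ [])) (⊗-idʳ _)) ≈-refl ⟨
      ⟦ word (x ∷ []) ⟧ᵖ ⊗ ⟦ q ⟧ᵖ                 ≈⟨ ⟦*ᵖ⟧ (word (x ∷ [])) q ⟨
      ⟦ word (x ∷ []) *ᵖ q ⟧ᵖ                     ∎

    rewriteStep : Word → Maybe Polynomial
    rewriteStep []      = nothing
    rewriteStep (x ∷ w) = rewriteFrom x w

    rewriteStep-sound : ∀ w {p} → rewriteStep w ≡ just p → ⟦ w ⟧ʷ ≈ ⟦ p ⟧ᵖ
    rewriteStep-sound (x ∷ w) = rewriteFrom-sound x w

    -- The fuel only bounds the number of rewriting steps; soundness holds for any fuel.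
    reduce : ℕ → Polynomial → Polynomial
    reduce zero    p             = p
    reduce (suc n) []            = []
    reduce (suc n) ((a , w) ∷ p) with rewriteStep w
    ... | just q  = reduce n (((a , []) ∷ []) *ᵖ q ++ p)
    ... | nothing = (a , w) ∷ reduce n p

    ⟦reduce⟧ : ∀ n p → ⟦ reduce n p ⟧ᵖ ≈ ⟦ p ⟧ᵖ
    ⟦reduce⟧ zero    p             = ≈-refl
    ⟦reduce⟧ (suc n) []            = ≈-refl
    ⟦reduce⟧ (suc n) ((a , w) ∷ p) with rewriteStep w in w≡q
    ... | just q  = begin
      ⟦ reduce n (((a , []) ∷ []) *ᵖ q ++ p) ⟧ᵖ          ≈⟨ ⟦reduce⟧ n _ ⟩
      ⟦ ((a , []) ∷ []) *ᵖ q ++ p ⟧ᵖ                     ≈⟨ ⟦++⟧ᵖ (((a , []) ∷ []) *ᵖ q) p ⟩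
      ⟦ ((a , []) ∷ []) *ᵖ q ⟧ᵖ ⊕ ⟦ p ⟧ᵖ                  ≈⟨ ⊕-cong (⟦*ᵖ⟧ ((a , []) ∷ []) q) ≈-refl ⟩
      (con ⟦ a ⟧ ⊗ con K.1# ⊕ con K.0#) ⊗ ⟦ q ⟧ᵖ ⊕ ⟦ p ⟧ᵖ
        ≈⟨ ⊕-cong (⊗-cong (≈-trans (+-identityʳ _) (⊗-idʳ _)) (≈-sym (rewriteStep-sound w w≡q))) ≈-refl ⟩
      con ⟦ a ⟧ ⊗ ⟦ w ⟧ʷ ⊕ ⟦ p ⟧ᵖ                         ∎
    ... | nothing = ⊕-cong ≈-refl (⟦reduce⟧ n p)

    module Evaluation {Q : Set} (val : Q → K.Carrier) (code : Q → Code)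
      (code-sound : ∀ q → ⟦ code q ⟧ K.≈ val q) where

      ⟦_⟧ₑ : Expr G Q → Term G
      ⟦ gen x ⟧ₑ = gen x
      ⟦ con q ⟧ₑ = con (val q)
      ⟦ e ⊕ f ⟧ₑ = ⟦ e ⟧ₑ ⊕ ⟦ f ⟧ₑ
      ⟦ e ⊗ f ⟧ₑ = ⟦ e ⟧ₑ ⊗ ⟦ f ⟧ₑ

      normalise : Expr G Q → Polynomial
      normalise (gen x) = word (x ∷ [])
      normalise (con q) = (code q , []) ∷ []
      normalise (e ⊕ f) = normalise e ++ normalise f
      normalise (e ⊗ f) = normalise e *ᵖ normalise f

      ⟦normalise⟧ : ∀ e → ⟦ normalise e ⟧ᵖ ≈ ⟦ e ⟧ₑ
      ⟦normalise⟧ (gen x) = ≈-trans (⟦word⟧ (x ∷ [])) (⊗-idʳ _)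
      ⟦normalise⟧ (con q) = ≈-trans (+-identityʳ _) (≈-trans (⊗-idʳ _) (con-cong (code-sound q)))
      ⟦normalise⟧ (e ⊕ f) =
        ≈-trans (⟦++⟧ᵖ (normalise e) (normalise f)) (⊕-cong (⟦normalise⟧ e) (⟦normalise⟧ f))
      ⟦normalise⟧ (e ⊗ f) =
        ≈-trans (⟦*ᵖ⟧ (normalise e) (normalise f)) (⊗-cong (⟦normalise⟧ e) (⟦normalise⟧ f))

      fuel : ℕ
      fuel = 100000

      _==_ : Expr G Q → Expr G Q → Bool
      e == f = isZeroᵖ (collect (reduce fuel (normalise e ++ -ᵖ normalise f)))

      ==-sound : ∀ e f → {T (e == f)} → ⟦ e ⟧ₑ ≈ ⟦ f ⟧ₑ
      ==-sound e f {e==f} = x∙y⁻¹≈ε⇒x≈y _ _ (begin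
        ⟦ e ⟧ₑ ⊕ - ⟦ f ⟧ₑ                              ≈⟨ ⊕-cong (⟦normalise⟧ e) (⊗-cong ≈-refl (⟦normalise⟧ f)) ⟨
        ⟦ normalise e ⟧ᵖ ⊕ - ⟦ normalise f ⟧ᵖ          ≈⟨ ⊕-cong ≈-refl (⟦-ᵖ⟧ (normalise f)) ⟨
        ⟦ normalise e ⟧ᵖ ⊕ ⟦ -ᵖ normalise f ⟧ᵖ         ≈⟨ ⟦++⟧ᵖ (normalise e) (-ᵖ normalise f) ⟨
        ⟦ d ⟧ᵖ                                        ≈⟨ ⟦reduce⟧ fuel d ⟨
        ⟦ reduce fuel d ⟧ᵖ                            ≈⟨ ⟦collect⟧ (reduce fuel d) ⟨
        ⟦ collect (reduce fuel d) ⟧ᵖ                  ≈⟨ isZeroᵖ-sound _ e==f ⟩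
        con K.0#                                      ∎)
        where d = normalise e ++ -ᵖ normalise f

infixl 6 _+′_
infixl 7 _*′_
infix  8 -′_

data Scalar : Set where
  i′ h′ one′ : Scalar
  _+′_ _*′_  : Scalar → Scalar → Scalar
  -′_        : Scalar → Scalar

two′ h⁴′ h⁶′ : Scalar
two′ = one′ +′ one′
h⁴′  = h′ *′ h′ *′ h′ *′ h′
h⁶′  = h⁴′ *′ h′ *′ h′

infixl 6 _⊖_
_⊖_ : {G : Set} → Expr G Scalar → Expr G Scalar → Expr G Scalar
e ⊖ f = e ⊕ con (-′ one′) ⊗ f

-- Copies of actUgen, ♯gen and actRgen with named constants: evaluating them with
-- ⟦_⟧ₑ gives the definitions of Defs on the nose, so the checks below are
-- statements about the original maps.
actUgenₑ : D3Gen → UGen → Expr UGen Scalar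
actUgenₑ σ E = con i′ ⊗ gen F
actUgenₑ σ F = con (-′ i′) ⊗ gen E
actUgenₑ σ H = con (-′ one′) ⊗ gen H
actUgenₑ τ E = con h′ ⊗ (gen H ⊖ con i′ ⊗ gen E ⊖ con i′ ⊗ gen F)
actUgenₑ τ F = con h′ ⊗ (gen H ⊕ con i′ ⊗ gen E ⊕ con i′ ⊗ gen F)
actUgenₑ τ H = con i′ ⊗ gen E ⊖ con i′ ⊗ gen F

♯genₑ : RGen → Expr UGen Scalar
♯genₑ A = con h⁴′ ⊗ ((gen E ⊕ gen F ⊖ con two′) ⊗ (gen E ⊕ gen F ⊕ con two′))
♯genₑ B = con h⁴′ ⊗ ((gen H ⊖ con two′) ⊗ (gen H ⊕ con two′))
♯genₑ C = con h⁴′ ⊗ ((con i′ ⊗ gen E ⊖ con i′ ⊗ gen F ⊖ con two′) ⊗ (con i′ ⊗ gen E ⊖ con i′ ⊗ gen F ⊕ con two′))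
♯genₑ Δ = con h⁶′ ⊗ ((gen H ⊕ con two′) ⊗ gen F ⊗ gen F ⊖ (gen H ⊖ con two′) ⊗ gen E ⊗ gen E)

actRgenₑ : D3Gen → RGen → Expr RGen Scalar
actRgenₑ σ A = gen C
actRgenₑ σ B = gen B
actRgenₑ σ C = gen A
actRgenₑ σ Δ = con (-′ one′) ⊗ gen Δ
actRgenₑ τ A = gen B
actRgenₑ τ B = gen C
actRgenₑ τ C = gen A
actRgenₑ τ Δ = gen Δ

_≟_ : DecidableEquality UGen
E ≟ E = yes ≡.refl
E ≟ F = no λ ()
E ≟ H = no λ ()
F ≟ E = no λ ()
F ≟ F = yes ≡.refl
F ≟ H = no λ ()
H ≟ E = no λ ()
H ≟ F = no λ ()
H ≟ H = yes ≡.refl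

module Sl2Equivariance {c ℓ} (K : CommutativeRing c ℓ) (i h : CommutativeRing.Carrier K)
  (i*i≈-1 : IsImaginaryUnit K i) (2h≈1 : IsHalf K h) where
  open CommutativeRing K using (Carrier; _≈_; _+_; _*_; -_; 1#)
  open Sl2Racah K i h hiding (_⊖_) renaming (_≈U_ to infix 4 _≈U_)
  private
    module K = CommutativeRing K
    module ℤ[i] = GaussianExtension (integers K) i i*i≈-1
    module ℤ[i,½] = DyadicExtension ℤ[i].coefficients h 2h≈1
    𝒞 = ℤ[i,½].coefficients
    module 𝒞 = Coefficients 𝒞
    module Cᵣ = RawRing 𝒞.rawRing

  val : Scalar → Carrier
  val i′       = i
  val h′       = h
  val one′     = 1#
  val (a +′ b) = val a + val b
  val (a *′ b) = val a * val b
  val (-′ a)   = - val a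

  code : Scalar → 𝒞.Code
  code i′       = ℤ[i,½].embed ℤ[i].√-1
  code h′       = ℤ[i,½].½
  code one′     = Cᵣ.1#
  code (a +′ b) = code a Cᵣ.+ code b
  code (a *′ b) = code a Cᵣ.* code b
  code (-′ a)   = Cᵣ.- code a

  code-sound : ∀ a → 𝒞.⟦ code a ⟧ ≈ val a
  code-sound i′       = K.trans (ℤ[i,½].⟦embed⟧ ℤ[i].√-1) ℤ[i].⟦√-1⟧
  code-sound h′       = ℤ[i,½].⟦½⟧
  code-sound one′     = 𝒞.1-homo
  code-sound (a +′ b) = K.trans (𝒞.+-homo (code a) (code b)) (K.+-cong (code-sound a) (code-sound b))
  code-sound (a *′ b) = K.trans (𝒞.*-homo (code a) (code b)) (K.*-cong (code-sound a) (code-sound b))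
  code-sound (-′ a)   = K.trans (𝒞.-‿homo (code a)) (K.-‿cong (code-sound a))

  open Normalisation 𝒞 _≟_ Sl2Rel
  open Ring (presentedRing K Sl2Rel) using (_-_; +-abelianGroup; setoid)
  open AbelianGroupProperties +-abelianGroup using (⁻¹-anti-homo‿-)
  open import Relation.Binary.Reasoning.Setoid setoid

  -- Rewriting towards the PBW basis F^a H^b E^c.
  commute : UGen → UGen → Maybe Polynomial
  commute E F = just ((code one′ , H ∷ []) ∷ [])
  commute E H = just ((code (-′ two′) , E ∷ []) ∷ [])
  commute H F = just ((code (-′ two′) , F ∷ []) ∷ [])
  commute _ _ = nothing

  ⟦code-single⟧ : ∀ a x → ⟦ (code a , x ∷ []) ∷ [] ⟧ᵖ ≈U con (val a) ⊗ gen x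
  ⟦code-single⟧ a x = ≈-trans (⟦single⟧ (code a) x) (⊗-cong (con-cong (code-sound a)) ≈-refl)

  commutator : ∀ {x y p} → commute x y ≡ just p → gen x ⊗ gen y - gen y ⊗ gen x ≈U ⟦ p ⟧ᵖ
  commutator {E} {E} ()
  commutator {E} {F} ≡.refl = ≈-trans (rel EF) (≈-sym (≈-trans (⟦code-single⟧ one′ H) (⊗-idˡ hh)))
  commutator {E} {H} ≡.refl = begin
    e ⊗ hh - hh ⊗ e                     ≈⟨ ⁻¹-anti-homo‿- (hh ⊗ e) (e ⊗ hh) ⟨
    con (- 1#) ⊗ (hh ⊗ e - e ⊗ hh)      ≈⟨ ⊗-cong ≈-refl (rel HE) ⟩
    con (- 1#) ⊗ (con two ⊗ e)          ≈⟨ ⊗-assoc _ _ _ ⟨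
    (con (- 1#) ⊗ con two) ⊗ e          ≈⟨ ⊗-cong (≈-trans (≈-sym (con-* _ _)) (con-cong (-1*x≈-x two))) ≈-refl ⟩
    con (- two) ⊗ e                     ≈⟨ ⟦code-single⟧ (-′ two′) E ⟨
    ⟦ (code (-′ two′) , E ∷ []) ∷ [] ⟧ᵖ ∎
    where open RingProperties K.ring using (-1*x≈-x)
  commutator {F} {_} ()
  commutator {H} {E} ()
  commutator {H} {F} ≡.refl = ≈-trans (rel HF) (≈-sym (⟦code-single⟧ (-′ two′) F))
  commutator {H} {H} ()

  open Rewriting commute commutator
  open Evaluation val code code-sound

  -- The implicit argument is ⊤ exactly when the normaliser succeeds, so at concrete g
  -- it is discharged by evaluation during type checking.
  relation-check : ∀ g (e f : Expr UGen Scalar) →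
    {T (extendₑ (actUgenₑ g) e == extendₑ (actUgenₑ g) f)} →
    ⟦ extendₑ (actUgenₑ g) e ⟧ₑ ≈U ⟦ extendₑ (actUgenₑ g) f ⟧ₑ
  relation-check g e f {eq} = ==-sound (extendₑ (actUgenₑ g) e) (extendₑ (actUgenₑ g) f) {eq}

  relation-preserved : ∀ g {x y} → Sl2Rel x y → extend (actUgen g) x ≈U extend (actUgen g) y
  relation-preserved σ HE = relation-check σ (gen H ⊗ gen E ⊖ gen E ⊗ gen H) (con two′ ⊗ gen E)
  relation-preserved σ HF = relation-check σ (gen H ⊗ gen F ⊖ gen F ⊗ gen H) (con (-′ two′) ⊗ gen F)
  relation-preserved σ EF = relation-check σ (gen E ⊗ gen F ⊖ gen F ⊗ gen E) (gen H)
  relation-preserved τ HE = relation-check τ (gen H ⊗ gen E ⊖ gen E ⊗ gen H) (con two′ ⊗ gen E)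
  relation-preserved τ HF = relation-check τ (gen H ⊗ gen F ⊖ gen F ⊗ gen H) (con (-′ two′) ⊗ gen F)
  relation-preserved τ EF = relation-check τ (gen E ⊗ gen F ⊖ gen F ⊗ gen E) (gen H)

  ♯-check : ∀ g r → {T (extendₑ (actUgenₑ g) (♯genₑ r) == extendₑ ♯genₑ (actRgenₑ g r))} →
    ⟦ extendₑ (actUgenₑ g) (♯genₑ r) ⟧ₑ ≈U ⟦ extendₑ ♯genₑ (actRgenₑ g r) ⟧ₑ
  ♯-check g r {eq} = ==-sound (extendₑ (actUgenₑ g) (♯genₑ r)) (extendₑ ♯genₑ (actRgenₑ g r)) {eq}

  ♯-commutes-on-generators : ∀ g r → extend (actUgen g) (♯gen r) ≈U ♯ (actRgen g r)
  ♯-commutes-on-generators σ A = ♯-check σ A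
  ♯-commutes-on-generators σ B = ♯-check σ B
  ♯-commutes-on-generators σ C = ♯-check σ C
  ♯-commutes-on-generators σ Δ = ♯-check σ Δ
  ♯-commutes-on-generators τ A = ♯-check τ A
  ♯-commutes-on-generators τ B = ♯-check τ B
  ♯-commutes-on-generators τ C = ♯-check τ C
  ♯-commutes-on-generators τ Δ = ♯-check τ Δ

theorem3p2 : ∀ {c ℓ} (K : CommutativeRing c ℓ) (i h : CommutativeRing.Carrier K) →
    CommutativeRing._≈_ K (CommutativeRing._*_ K i i) (CommutativeRing.-_ K (CommutativeRing.1# K)) →
    CommutativeRing._≈_ K (CommutativeRing._*_ K (CommutativeRing._+_ K (CommutativeRing.1# K) (CommutativeRing.1# K)) h) (CommutativeRing.1# K) →
    (g : List D3Gen) (x : Sl2Racah.RTerm K i h) →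
    Sl2Racah._≈U_ K i h (Sl2Racah.actU K i h g (Sl2Racah.♯ K i h x)) (Sl2Racah.♯ K i h (Sl2Racah.actR K i h g x))
theorem3p2 K i h i*i≈-1 2h≈1 = ♯-equivariant
  where
  open Sl2Racah K i h
  open Sl2Equivariance K i h i*i≈-1 2h≈1

  ♯-equivariant : ∀ gs x → actU gs (♯ x) ≈U ♯ (actR gs x)
  ♯-equivariant []       x = ≈-refl
  ♯-equivariant (g ∷ gs) x =
    ≈-trans (extend-cong K (actUgen g) (relation-preserved g) (♯-equivariant gs x))
            (extend-intertwines K ♯gen (actUgen g) (actRgen g) (♯-commutes-on-generators g) (actR gs x))
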